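{- Let $H$ be a finite graph and $L$ a list-assignment of $H$ such that $|L(v)|\ge \deg(v)+1$ for every vertex $v\in V(H)$. Let $\boldsymbol{\sigma}$ be a uniformly random proper $L$-colouring of $H$. Then for every colour $x\in \bigcup_{v\in V(H)} L(v)$, the probability that $\boldsymbol{\sigma}(v)\neq x$ for all $v\in V(H)$ is at least \[ \prod_{v\in V(H)} \left(1- \frac{1}{|L(v)|-\deg(v)}\right).\]
   Context: A list-assignment is a map $L\colon V(H)\to 2^{\mathbb{N}}$; a proper $L$-colouring is a map $c$ with $c(v)\in L(v)$ for all $v$ and $c(u)\ne c(v)$ for all edges $uv$. $\deg(v)$ is the degree of $v$ in $H$. -}

module Defs where

open import Data.Nat using (ℕ; zero; suc; _∸_; _≡ᵇ_)
open import Data.Fin using (Fin)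
import Data.Fin as F
open import Data.Bool using (Bool; true; false; not; _∨_; T)
open import Data.List using (List; []; _∷_; [_]; map; concatMap; length; filter; allFin; foldr)
open import Data.Bool.ListAction using (all)
open import Data.Vec using (Vec; lookup) renaming ([] to []ᵥ; _∷_ to _∷ᵥ_)
open import Data.Integer using (+_)
open import Data.Rational using (ℚ; _/_; 1ℚ; 0ℚ; _-_; _*_)
open import Relation.Binary.PropositionalEquality using (_≡_)
open import Relation.Nullary using (¬_)
open import Relation.Nullary.Decidable using (does)
open import Data.Bool.Properties using (T?)

record Graph (n : ℕ) : Set where
  field
    adj   : Fin n → Fin n → Bool
    sym   : ∀ u v → adj u v ≡ adj v u
    irrefl : ∀ v → adj v v ≡ false
open Graph public

deg : ∀ {n} → Graph n → Fin n → ℕ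
deg {n} H v = length (filter (λ u → T? (adj H v u)) (allFin n))

-- All maps c with c(v) ∈ L(v), as vectors, listed once each (when the lists L v are duplicate-free).
choices : ∀ n → (Fin n → List ℕ) → List (Vec ℕ n)
choices zero L = [ []ᵥ ]
choices (suc n) L = concatMap (λ a → map (a ∷ᵥ_) (choices n (λ v → L (F.suc v)))) (L F.zero)

properᵇ : ∀ {n} → Graph n → Vec ℕ n → Bool
properᵇ {n} H c = all (λ u → all (λ v → not (adj H u v) ∨ not (lookup c u ≡ᵇ lookup c v)) (allFin n)) (allFin n)

avoidsᵇ : ∀ {n} → ℕ → Vec ℕ n → Bool
avoidsᵇ {n} x c = all (λ v → not (lookup c v ≡ᵇ x)) (allFin n)

#proper : ∀ {n} → Graph n → (Fin n → List ℕ) → ℕ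
#proper {n} H L = length (filter (λ c → T? (properᵇ H c)) (choices n L))

#properAvoiding : ∀ {n} → Graph n → (Fin n → List ℕ) → ℕ → ℕ
#properAvoiding {n} H L x =
  length (filter (λ c → T? (avoidsᵇ x c)) (filter (λ c → T? (properᵇ H c)) (choices n L)))

-- 1 - 1/(a - d); the case a - d = 0 never occurs under the hypothesis |L v| ≥ deg v + 1
factor : ℕ → ℕ → ℚ
factor a d with a ∸ d
... | zero = 0ℚ
... | suc k = 1ℚ - (+ 1 / suc k)

bound : ∀ {n} → Graph n → (Fin n → List ℕ) → ℚ
bound {n} H L = foldr (λ v r → factor (length (L v)) (deg H v) * r) 1ℚ (allFin n)

ℕ→ℚ : ℕ → ℚ
ℕ→ℚ k = + k / 1

-- Strengthen the claim (avoiding-lower-bound): whenever k v + deg v ≤ |L v| for every v,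
--   ∏ (k v − 1) · #proper ≤ ∏ k v · #avoiding x,
-- which for k v = |L v| − deg v is the theorem, since 1 − 1/k = (k − 1)/k.
-- Induct on the number of vertices, colouring vertex zero first. Giving it colour a deletes a
-- from the lists of its neighbours, whose degrees drop by one, so the colourings of the other
-- vertices form an instance with the same k; this bounds the colourings with σ(0) ≠ x. Those with
-- σ(0) = x are compared with those with σ(0) ≠ x by double counting: every proper colouring of the
-- other vertices leaves at least k 0 colours of L 0 free for vertex zero, and at most one of them is x.

module Submission where

open import Defs renaming (sym to adj-sym)
open import Data.Nat using (ℕ; zero; suc; _≤_)
open import Data.Nat.ListAction using (product)
open import Data.Fin using (Fin; zero; suc)
open import Data.List using (List; []; _∷_; length; map; foldr; allFin)
open import Data.List.Relation.Unary.Unique.Propositional using (Unique)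
open import Data.List.Membership.Propositional using (_∈_)
open import Data.Product using (∃; proj₁)
open import Function using (_∘_)
open import Relation.Binary.PropositionalEquality
open import Algebra.Bundles using (CommutativeMonoid)
import Algebra.Properties.CommutativeSemigroup as CommSemigroupProperties

module Counting where

  open import Data.Nat using (_+_; _*_; _∸_; _≡ᵇ_; z≤n; s≤s)
  open import Data.Nat.Properties
  open import Data.Nat.Solver using (module +-*-Solver)
  open import Data.Bool using (Bool; true; false; not; _∧_; _∨_; T)
  import Data.Bool.Properties as Bool
  open import Data.Bool.ListAction using (all; and)
  open import Data.Vec using (Vec; lookup) renaming ([] to []ᵥ; _∷_ to _∷ᵥ_)
  open import Data.List using (_++_; concatMap; filterᵇ)
  open import Data.List.Properties using (map-tabulate; map-∘)
  open import Data.List.Relation.Unary.All using (All; []; _∷_)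
  open import Data.List.Relation.Unary.AllPairs using (_∷_)
  open import Data.List.Relation.Unary.Unique.Propositional.Properties using (filter⁺)
  open import Data.Empty using (⊥-elim)
  open import Function.Bundles using (Equivalence)
  open import Relation.Nullary.Decidable using (T?)

  open CommSemigroupProperties +-commutativeSemigroup using () renaming (interchange to +-interchange)
  open CommSemigroupProperties (CommutativeMonoid.commutativeSemigroup Bool.∧-commutativeMonoid)
    using () renaming (interchange to ∧-interchange; x∙yz≈y∙xz to ∧-swapˡ; xy∙z≈xz∙y to ∧-swapʳ)

  private
    variable
      A B : Set
      V : Set
      n : ℕ

  ∑ : List A → (A → ℕ) → ℕ
  ∑ []       f = 0
  ∑ (x ∷ xs) f = f x + ∑ xs f

  infix 5 ∑
  syntax ∑ xs (λ x → e) = ∑[ x ∈ xs ] e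

  when : Bool → ℕ → ℕ
  when true  m = m
  when false m = 0

  countᵇ : (A → Bool) → List A → ℕ
  countᵇ p xs = ∑[ x ∈ xs ] when (p x) 1

  ∑-cong : ∀ (xs : List A) {f g : A → ℕ} → (∀ x → f x ≡ g x) → ∑ xs f ≡ ∑ xs g
  ∑-cong []       f≗g = refl
  ∑-cong (x ∷ xs) f≗g = cong₂ _+_ (f≗g x) (∑-cong xs f≗g)

  ∑-zero : ∀ (xs : List A) → ∑[ x ∈ xs ] 0 ≡ 0
  ∑-zero []       = refl
  ∑-zero (x ∷ xs) = ∑-zero xs

  ∑-++ : ∀ (xs ys : List A) f → ∑ (xs ++ ys) f ≡ ∑ xs f + ∑ ys f
  ∑-++ []       ys f = refl
  ∑-++ (x ∷ xs) ys f = trans (cong (f x +_) (∑-++ xs ys f)) (sym (+-assoc (f x) _ _))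

  ∑-map : ∀ (g : B → A) (xs : List B) f → ∑ (map g xs) f ≡ ∑[ x ∈ xs ] f (g x)
  ∑-map g []       f = refl
  ∑-map g (x ∷ xs) f = cong (f (g x) +_) (∑-map g xs f)

  ∑-concatMap : ∀ (g : B → List A) (xs : List B) f → ∑ (concatMap g xs) f ≡ ∑[ x ∈ xs ] ∑ (g x) f
  ∑-concatMap g []       f = refl
  ∑-concatMap g (x ∷ xs) f = trans (∑-++ (g x) _ f) (cong (∑ (g x) f +_) (∑-concatMap g xs f))

  ∑-+ : ∀ (xs : List A) f g → ∑[ x ∈ xs ] (f x + g x) ≡ ∑ xs f + ∑ xs g
  ∑-+ []       f g = refl
  ∑-+ (x ∷ xs) f g = trans (cong (f x + g x +_) (∑-+ xs f g)) (+-interchange (f x) (g x) _ _)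

  ∑-comm : ∀ (xs : List A) (ys : List B) (f : A → B → ℕ) →
    ∑[ x ∈ xs ] ∑[ y ∈ ys ] f x y ≡ ∑[ y ∈ ys ] ∑[ x ∈ xs ] f x y
  ∑-comm xs []       f = ∑-zero xs
  ∑-comm xs (y ∷ ys) f = trans (∑-+ xs (λ x → f x y) _) (cong (∑ xs (λ x → f x y) +_) (∑-comm xs ys f))

  *-∑ : ∀ m (xs : List A) f → m * ∑ xs f ≡ ∑[ x ∈ xs ] m * f x
  *-∑ m []       f = *-zeroʳ m
  *-∑ m (x ∷ xs) f = trans (*-distribˡ-+ m (f x) _) (cong (m * f x +_) (*-∑ m xs f))

  ∑-mono-≤ : ∀ (xs : List A) {f g : A → ℕ} → (∀ x → f x ≤ g x) → ∑ xs f ≤ ∑ xs g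
  ∑-mono-≤ []       f≤g = z≤n
  ∑-mono-≤ (x ∷ xs) f≤g = +-mono-≤ (f≤g x) (∑-mono-≤ xs f≤g)

  ∑-filterᵇ : ∀ (p : A → Bool) xs f → ∑ (filterᵇ p xs) f ≡ ∑[ x ∈ xs ] when (p x) (f x)
  ∑-filterᵇ p []       f = refl
  ∑-filterᵇ p (x ∷ xs) f with p x
  ... | true  = cong (f x +_) (∑-filterᵇ p xs f)
  ... | false = ∑-filterᵇ p xs f

  when-mono-≤ : ∀ b {m n} → m ≤ n → when b m ≤ when b n
  when-mono-≤ true  m≤n = m≤n
  when-mono-≤ false m≤n = z≤n

  *-when : ∀ m b n → m * when b n ≡ when b (m * n)
  *-when m true  n = refl
  *-when m false n = *-zeroʳ m

  *-∑-when-mono-≤ : ∀ m m′ (xs : List A) (b : A → Bool) {f g : A → ℕ} → (∀ x → m * f x ≤ m′ * g x) →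
    m * (∑[ x ∈ xs ] when (b x) (f x)) ≤ m′ * (∑[ x ∈ xs ] when (b x) (g x))
  *-∑-when-mono-≤ m m′ xs b {f} {g} mf≤m′g = begin
    m * (∑[ x ∈ xs ] when (b x) (f x))     ≡⟨ *-∑ m xs _ ⟩
    ∑[ x ∈ xs ] m * when (b x) (f x)       ≡⟨ ∑-cong xs (λ x → *-when m (b x) (f x)) ⟩
    ∑[ x ∈ xs ] when (b x) (m * f x)       ≤⟨ ∑-mono-≤ xs (λ x → when-mono-≤ (b x) (mf≤m′g x)) ⟩
    ∑[ x ∈ xs ] when (b x) (m′ * g x)      ≡⟨ ∑-cong xs (λ x → *-when m′ (b x) (g x)) ⟨
    ∑[ x ∈ xs ] m′ * when (b x) (g x)      ≡⟨ *-∑ m′ xs _ ⟨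
    m′ * (∑[ x ∈ xs ] when (b x) (g x))    ∎
    where open ≤-Reasoning

  ∸1*≤ : ∀ k {g h} → g ≤ 1 → k ≤ g + h → (k ∸ 1) * g ≤ h
  ∸1*≤ k       {zero}        _        _         = ≤-trans (≤-reflexive (*-zeroʳ (k ∸ 1))) z≤n
  ∸1*≤ zero    {suc zero}    _        _         = z≤n
  ∸1*≤ (suc k) {suc zero}    _        (s≤s k≤h) = ≤-trans (≤-reflexive (*-identityʳ k)) k≤h
  ∸1*≤ k       {suc (suc g)} (s≤s ()) _

  combine-≤ : ∀ k {p q s t a} → (k ∸ 1) * t ≤ s → p * s ≤ q * a → ((k ∸ 1) * p) * (s + t) ≤ (k * q) * a
  combine-≤ zero    _    _    = z≤n
  combine-≤ (suc k) {p} {q} {s} {t} {a} kt≤s ps≤qa = begin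
    (k * p) * (s + t)    ≡⟨ solve 4 (λ k p s t → (k :* p) :* (s :+ t) := p :* (k :* s :+ k :* t)) refl k p s t ⟩
    p * (k * s + k * t)  ≤⟨ *-monoʳ-≤ p (+-monoʳ-≤ (k * s) kt≤s) ⟩
    p * (k * s + s)      ≡⟨ solve 3 (λ k p s → p :* (k :* s :+ s) := (con 1 :+ k) :* (p :* s)) refl k p s ⟩
    suc k * (p * s)      ≤⟨ *-monoʳ-≤ (suc k) ps≤qa ⟩
    suc k * (q * a)      ≡⟨ *-assoc (suc k) q a ⟨
    (suc k * q) * a      ∎
    where
    open ≤-Reasoning
    open +-*-Solver

  when-countᵇ : ∀ b (f : A → Bool) xs → when b (countᵇ f xs) ≡ countᵇ (λ x → b ∧ f x) xs
  when-countᵇ true  f xs = refl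
  when-countᵇ false f xs = sym (∑-zero xs)

  countᵇ-cong : ∀ (xs : List A) {f g : A → Bool} → (∀ x → f x ≡ g x) → countᵇ f xs ≡ countᵇ g xs
  countᵇ-cong xs f≗g = ∑-cong xs (λ x → cong (λ b → when b 1) (f≗g x))

  countᵇ-filterᵇ : ∀ (p f : A → Bool) xs → countᵇ f (filterᵇ p xs) ≡ countᵇ (λ x → p x ∧ f x) xs
  countᵇ-filterᵇ p f xs = trans (∑-filterᵇ p xs _) (∑-cong xs (λ x → when-when (p x) (f x)))
    where
    when-when : ∀ b c → when b (when c 1) ≡ when (b ∧ c) 1
    when-when true  c = refl
    when-when false c = refl

  length-filterᵇ : ∀ (p : A → Bool) xs → length (filterᵇ p xs) ≡ countᵇ p xs
  length-filterᵇ p []       = refl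
  length-filterᵇ p (x ∷ xs) with p x
  ... | true  = cong suc (length-filterᵇ p xs)
  ... | false = length-filterᵇ p xs

  countᵇ-true : ∀ (xs : List A) → countᵇ (λ _ → true) xs ≡ length xs
  countᵇ-true []       = refl
  countᵇ-true (x ∷ xs) = cong suc (countᵇ-true xs)

  countᵇ-∧-split : ∀ (p f : A → Bool) xs →
    countᵇ (λ x → p x ∧ f x) xs + countᵇ (λ x → not (p x) ∧ f x) xs ≡ countᵇ f xs
  countᵇ-∧-split p f []       = refl
  countᵇ-∧-split p f (x ∷ xs) with p x | f x
  ... | true  | true  = cong suc (countᵇ-∧-split p f xs)
  ... | true  | false = countᵇ-∧-split p f xs
  ... | false | true  = trans (+-suc _ _) (cong suc (countᵇ-∧-split p f xs))
  ... | false | false = countᵇ-∧-split p f xs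

  countᵇ-mono-≤ : ∀ (xs : List A) {f g : A → Bool} → (∀ x → T (f x) → T (g x)) → countᵇ f xs ≤ countᵇ g xs
  countᵇ-mono-≤ []       f⇒g = z≤n
  countᵇ-mono-≤ (x ∷ xs) {f} {g} f⇒g with f x | g x | f⇒g x
  ... | true  | true  | _   = s≤s (countᵇ-mono-≤ xs f⇒g)
  ... | true  | false | fx⇒ = ⊥-elim (fx⇒ _)
  ... | false | true  | _   = ≤-trans (countᵇ-mono-≤ xs f⇒g) (n≤1+n _)
  ... | false | false | _   = countᵇ-mono-≤ xs f⇒g

  countᵇ-≤-∧+not : ∀ (p f : A → Bool) xs → countᵇ f xs ≤ countᵇ (λ x → p x ∧ f x) xs + countᵇ (not ∘ p) xs
  countᵇ-≤-∧+not p f xs = begin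
    countᵇ f xs
      ≡⟨ countᵇ-∧-split p f xs ⟨
    countᵇ (λ x → p x ∧ f x) xs + countᵇ (λ x → not (p x) ∧ f x) xs
      ≤⟨ +-monoʳ-≤ _ (countᵇ-mono-≤ xs (λ x → proj₁ ∘ Equivalence.to Bool.T-∧)) ⟩
    countᵇ (λ x → p x ∧ f x) xs + countᵇ (not ∘ p) xs
      ∎
    where open ≤-Reasoning

  countᵇ+countᵇ-not : ∀ (p : A → Bool) xs → countᵇ p xs + countᵇ (not ∘ p) xs ≡ length xs
  countᵇ+countᵇ-not p xs = begin
    countᵇ p xs + countᵇ (not ∘ p) xs                                    ≡⟨ cong₂ _+_ (∧-true p) (∧-true (not ∘ p)) ⟨
    countᵇ (λ x → p x ∧ true) xs + countᵇ (λ x → not (p x) ∧ true) xs  ≡⟨ countᵇ-∧-split p (λ _ → true) xs ⟩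
    countᵇ (λ _ → true) xs                                               ≡⟨ countᵇ-true xs ⟩
    length xs                                                            ∎
    where
    open ≡-Reasoning
    ∧-true : ∀ q → countᵇ (λ x → q x ∧ true) xs ≡ countᵇ q xs
    ∧-true q = countᵇ-cong xs (λ x → Bool.∧-identityʳ (q x))

  ≡ᵇ-sym : ∀ a b → (a ≡ᵇ b) ≡ (b ≡ᵇ a)
  ≡ᵇ-sym zero    zero    = refl
  ≡ᵇ-sym zero    (suc b) = refl
  ≡ᵇ-sym (suc a) zero    = refl
  ≡ᵇ-sym (suc a) (suc b) = ≡ᵇ-sym a b

  countᵇ-≡ᵇ-∉ : ∀ {a} (xs : List ℕ) → All (a ≢_) xs → countᵇ (_≡ᵇ a) xs ≡ 0
  countᵇ-≡ᵇ-∉     []       []             = refl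
  countᵇ-≡ᵇ-∉ {a} (y ∷ xs) (a≢y ∷ a∉xs) with y ≡ᵇ a in y≡ᵇa
  ... | true  = ⊥-elim (a≢y (sym (≡ᵇ⇒≡ y a (subst T (sym y≡ᵇa) _))))
  ... | false = countᵇ-≡ᵇ-∉ xs a∉xs

  countᵇ-≡ᵇ-≤1 : ∀ a {xs : List ℕ} → Unique xs → countᵇ (_≡ᵇ a) xs ≤ 1
  countᵇ-≡ᵇ-≤1 a {[]}     _               = z≤n
  countᵇ-≡ᵇ-≤1 a {y ∷ xs} (y∉xs ∷ unique) with y ≡ᵇ a in y≡ᵇa
  ... | true  = s≤s (≤-reflexive (countᵇ-≡ᵇ-∉ xs (subst (λ z → All (z ≢_) xs) y≡a y∉xs)))
    where
    y≡a : y ≡ a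
    y≡a = ≡ᵇ⇒≡ y a (subst T (sym y≡ᵇa) _)
  ... | false = countᵇ-≡ᵇ-≤1 a unique

  free : (V → Bool) → (V → ℕ) → List V → ℕ → Bool
  free marked val us a = all (λ u → not (marked u) ∨ not (a ≡ᵇ val u)) us

  countᵇ-blocked-≤ : ∀ b c {xs} → Unique xs → countᵇ (λ a → not (not b ∨ not (a ≡ᵇ c))) xs ≤ when b 1
  countᵇ-blocked-≤ false c {xs} _      = ≤-reflexive (∑-zero xs)
  countᵇ-blocked-≤ true  c {xs} unique = begin
    countᵇ (λ a → not (not (a ≡ᵇ c))) xs  ≡⟨ countᵇ-cong xs (λ a → Bool.not-involutive (a ≡ᵇ c)) ⟩
    countᵇ (_≡ᵇ c) xs                      ≤⟨ countᵇ-≡ᵇ-≤1 c unique ⟩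
    1                                      ∎
    where open ≤-Reasoning

  length≤countᵇ-free+countᵇ-marked : ∀ {xs} → Unique xs → (marked : V → Bool) (val : V → ℕ) (us : List V) →
    length xs ≤ countᵇ (free marked val us) xs + countᵇ marked us
  length≤countᵇ-free+countᵇ-marked {xs = xs} unique marked val [] =
    ≤-reflexive (sym (trans (+-identityʳ _) (countᵇ-true xs)))
  length≤countᵇ-free+countᵇ-marked {xs = xs} unique marked val (u ∷ us) = begin
    length xs
      ≤⟨ length≤countᵇ-free+countᵇ-marked unique marked val us ⟩
    countᵇ (free marked val us) xs + countᵇ marked us
      ≤⟨ +-monoˡ-≤ (countᵇ marked us) (countᵇ-≤-∧+not allowed (free marked val us) xs) ⟩
    F + countᵇ (not ∘ allowed) xs + countᵇ marked us
      ≤⟨ +-monoˡ-≤ (countᵇ marked us) (+-monoʳ-≤ F (countᵇ-blocked-≤ (marked u) (val u) unique)) ⟩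
    F + when (marked u) 1 + countᵇ marked us
      ≡⟨ +-assoc F _ _ ⟩
    F + countᵇ marked (u ∷ us)
      ∎
    where
    open ≤-Reasoning
    F : ℕ
    F = countᵇ (free marked val (u ∷ us)) xs
    allowed : ℕ → Bool
    allowed a = not (marked u) ∨ not (a ≡ᵇ val u)

  allFin-suc : allFin (suc n) ≡ zero ∷ map suc (allFin n)
  allFin-suc = cong (zero ∷_) (sym (map-tabulate (λ i → i) suc))

  all-allFin-suc : ∀ (p : Fin (suc n) → Bool) → all p (allFin (suc n)) ≡ p zero ∧ all (p ∘ suc) (allFin n)
  all-allFin-suc p = cong (p zero ∧_) (cong and (trans (map-tabulate suc p) (sym (map-tabulate (λ i → i) (p ∘ suc)))))

  countᵇ-allFin-suc : ∀ (p : Fin (suc n) → Bool) →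
    countᵇ p (allFin (suc n)) ≡ when (p zero) 1 + countᵇ (p ∘ suc) (allFin n)
  countᵇ-allFin-suc {n} p =
    trans (cong (countᵇ p) allFin-suc) (cong (when (p zero) 1 +_) (∑-map suc (allFin n) (λ v → when (p v) 1)))

  all-cong : ∀ (xs : List A) {p q : A → Bool} → (∀ x → p x ≡ q x) → all p xs ≡ all q xs
  all-cong []       p≗q = refl
  all-cong (x ∷ xs) p≗q = cong₂ _∧_ (p≗q x) (all-cong xs p≗q)

  all-∧ : ∀ (p q : A → Bool) xs → all (λ x → p x ∧ q x) xs ≡ all p xs ∧ all q xs
  all-∧ p q []       = refl
  all-∧ p q (x ∷ xs) = trans (cong ((p x ∧ q x) ∧_) (all-∧ p q xs)) (∧-interchange (p x) (q x) _ _)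

  delete₀ : Graph (suc n) → Graph n
  delete₀ H = record
    { adj    = λ u v → adj H (suc u) (suc v)
    ; sym    = λ u v → adj-sym H (suc u) (suc v)
    ; irrefl = λ v → irrefl H (suc v)
    }

  -- u : Fin n stands for vertex suc u of H, and a is the colour of vertex zero.
  allowed : Graph (suc n) → ℕ → Fin n → ℕ → Bool
  allowed H a u b = not (adj H zero (suc u)) ∨ not (a ≡ᵇ b)

  compatible₀ : Graph (suc n) → ℕ → Vec ℕ n → Bool
  compatible₀ H a c = free (λ u → adj H zero (suc u)) (lookup c) (allFin _) a

  properᵇ-∷ : ∀ (H : Graph (suc n)) a c → properᵇ H (a ∷ᵥ c) ≡ properᵇ (delete₀ H) c ∧ compatible₀ H a c
  properᵇ-∷ {n} H a c = begin
    properᵇ H (a ∷ᵥ c)                                 ≡⟨ all-allFin-suc row ⟩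
    row zero ∧ all (row ∘ suc) (allFin n)              ≡⟨ cong₂ _∧_ row-zero rows-suc ⟩
    compatible₀ H a c ∧ (compatible₀ H a c ∧ properᵇ (delete₀ H) c)
                                                       ≡⟨ ∧-dup (compatible₀ H a c) _ ⟩
    properᵇ (delete₀ H) c ∧ compatible₀ H a c          ∎
    where
    open ≡-Reasoning
    clash : Fin (suc n) → Fin (suc n) → Bool
    clash u v = not (adj H u v) ∨ not (lookup (a ∷ᵥ c) u ≡ᵇ lookup (a ∷ᵥ c) v)
    row : Fin (suc n) → Bool
    row u = all (clash u) (allFin (suc n))
    row-zero : row zero ≡ compatible₀ H a c
    row-zero = trans (all-allFin-suc (clash zero))
                     (cong (λ b → (not b ∨ not (a ≡ᵇ a)) ∧ compatible₀ H a c) (irrefl H zero))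
    rows-suc : all (row ∘ suc) (allFin n) ≡ compatible₀ H a c ∧ properᵇ (delete₀ H) c
    rows-suc = trans (all-cong (allFin n) (λ u → trans (all-allFin-suc (clash (suc u)))
                       (cong (_∧ _) (cong₂ (λ e d → not e ∨ not d) (adj-sym H (suc u) zero) (≡ᵇ-sym (lookup c u) a)))))
                     (all-∧ (λ u → allowed H a u (lookup c u)) _ (allFin n))
    ∧-dup : ∀ x y → x ∧ (x ∧ y) ≡ y ∧ x
    ∧-dup true  y = sym (Bool.∧-identityʳ y)
    ∧-dup false y = sym (Bool.∧-zeroʳ y)

  avoidsᵇ-∷ : ∀ x a (c : Vec ℕ n) → avoidsᵇ x (a ∷ᵥ c) ≡ not (a ≡ᵇ x) ∧ avoidsᵇ x c
  avoidsᵇ-∷ x a c = all-allFin-suc (λ v → not (lookup (a ∷ᵥ c) v ≡ᵇ x))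

  deg≡countᵇ : ∀ (H : Graph n) v → deg H v ≡ countᵇ (adj H v) (allFin n)
  deg≡countᵇ {n} H v = length-filterᵇ (adj H v) (allFin n)

  deg-zero : ∀ (H : Graph (suc n)) → deg H zero ≡ countᵇ (λ u → adj H zero (suc u)) (allFin n)
  deg-zero H = trans (deg≡countᵇ H zero) (trans (countᵇ-allFin-suc (adj H zero))
    (cong (λ b → when b 1 + countᵇ (λ u → adj H zero (suc u)) (allFin _)) (irrefl H zero)))

  deg-suc : ∀ (H : Graph (suc n)) u → deg H (suc u) ≡ when (adj H zero (suc u)) 1 + deg (delete₀ H) u
  deg-suc H u = trans (deg≡countᵇ H (suc u)) (trans (countᵇ-allFin-suc (adj H (suc u)))
    (cong₂ (λ b m → when b 1 + m) (adj-sym H (suc u) zero) (sym (deg≡countᵇ (delete₀ H) u))))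

  ∏ᶠ : (Fin n → ℕ) → ℕ
  ∏ᶠ {n} f = product (map f (allFin n))

  ∏ᶠ-suc : ∀ (f : Fin (suc n) → ℕ) → ∏ᶠ f ≡ f zero * ∏ᶠ (f ∘ suc)
  ∏ᶠ-suc {n} f = trans (cong (product ∘ map f) allFin-suc) (cong (λ xs → f zero * product xs) (sym (map-∘ (allFin n))))

  #colourings : ∀ n → (Fin n → List ℕ) → (Vec ℕ n → Bool) → ℕ
  #colourings n L p = countᵇ p (choices n L)

  #proper≡#colourings : ∀ (H : Graph n) L → #proper H L ≡ #colourings n L (properᵇ H)
  #proper≡#colourings {n} H L = length-filterᵇ (properᵇ H) (choices n L)

  #properAvoiding≡#colourings : ∀ (H : Graph n) L x →
    #properAvoiding H L x ≡ #colourings n L (λ c → properᵇ H c ∧ avoidsᵇ x c)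
  #properAvoiding≡#colourings {n} H L x = trans (length-filterᵇ (avoidsᵇ x) (filterᵇ (properᵇ H) (choices n L)))
                                                (countᵇ-filterᵇ (properᵇ H) (avoidsᵇ x) (choices n L))

  #colourings-∷ : ∀ (L : Fin (suc n) → List ℕ) p →
    #colourings (suc n) L p ≡ ∑[ a ∈ L zero ] #colourings n (L ∘ suc) (λ c → p (a ∷ᵥ c))
  #colourings-∷ {n} L p = trans (∑-concatMap _ (L zero) (λ c → when (p c) 1))
    (∑-cong (L zero) (λ a → ∑-map (a ∷ᵥ_) (choices n (L ∘ suc)) (λ c → when (p c) 1)))

  #colourings-filterᵇ : ∀ n (L : Fin n → List ℕ) (q : Fin n → ℕ → Bool) p →
    #colourings n (λ u → filterᵇ (q u) (L u)) p ≡ #colourings n L (λ c → p c ∧ all (λ u → q u (lookup c u)) (allFin n))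
  #colourings-filterᵇ zero    L q p = cong (λ b → when b 1 + 0) (sym (Bool.∧-identityʳ (p []ᵥ)))
  #colourings-filterᵇ (suc n) L q p = begin
    #colourings (suc n) L′ p
      ≡⟨ #colourings-∷ L′ p ⟩
    ∑[ a ∈ filterᵇ (q zero) (L zero) ] #colourings n (L′ ∘ suc) (λ c → p (a ∷ᵥ c))
      ≡⟨ ∑-filterᵇ (q zero) (L zero) (λ a → #colourings n (L′ ∘ suc) (λ c → p (a ∷ᵥ c))) ⟩
    ∑[ a ∈ L zero ] when (q zero a) (#colourings n (L′ ∘ suc) (λ c → p (a ∷ᵥ c)))
      ≡⟨ ∑-cong (L zero) (λ a →
           cong (when (q zero a)) (#colourings-filterᵇ n (L ∘ suc) (q ∘ suc) (λ c → p (a ∷ᵥ c)))) ⟩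
    ∑[ a ∈ L zero ] when (q zero a) (#colourings n (L ∘ suc) (λ c → p (a ∷ᵥ c) ∧ rest c))
      ≡⟨ ∑-cong (L zero) (λ a → when-countᵇ (q zero a) (λ c → p (a ∷ᵥ c) ∧ rest c) (choices n (L ∘ suc))) ⟩
    ∑[ a ∈ L zero ] #colourings n (L ∘ suc) (λ c → q zero a ∧ (p (a ∷ᵥ c) ∧ rest c))
      ≡⟨ ∑-cong (L zero) (λ a → countᵇ-cong (choices n (L ∘ suc)) (λ c →
           trans (∧-swapˡ (q zero a) (p (a ∷ᵥ c)) (rest c))
                 (cong (p (a ∷ᵥ c) ∧_) (sym (all-allFin-suc (fits (a ∷ᵥ c))))))) ⟩
    ∑[ a ∈ L zero ] #colourings n (L ∘ suc) (λ c → p (a ∷ᵥ c) ∧ all (fits (a ∷ᵥ c)) (allFin (suc n)))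
      ≡⟨ #colourings-∷ L (λ c → p c ∧ all (fits c) (allFin (suc n))) ⟨
    #colourings (suc n) L (λ c → p c ∧ all (fits c) (allFin (suc n))) ∎
    where
    open ≡-Reasoning
    fits : Vec ℕ (suc n) → Fin (suc n) → Bool
    fits c u = q u (lookup c u)
    L′ : Fin (suc n) → List ℕ
    L′ u = filterᵇ (q u) (L u)
    rest : Vec ℕ n → Bool
    rest c = all (λ u → q (suc u) (lookup c u)) (allFin n)

  module Extension {n} (H : Graph (suc n)) (L : Fin (suc n) → List ℕ) (k : Fin (suc n) → ℕ)
    (unique : ∀ v → Unique (L v)) (room : ∀ v → k v + deg H v ≤ length (L v)) (x : ℕ) where

    H′ : Graph n
    H′ = delete₀ H

    restricted : ℕ → Fin n → List ℕ
    restricted a u = filterᵇ (allowed H a u) (L (suc u))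

    restricted-unique : ∀ a u → Unique (restricted a u)
    restricted-unique a u = filter⁺ (T? ∘ allowed H a u) (unique (suc u))

    -- A neighbour of vertex zero loses one colour and one unit of degree.
    restricted-room : ∀ a u → k (suc u) + deg H′ u ≤ length (restricted a u)
    restricted-room a u = +-cancelʳ-≤ (when (adj H zero (suc u)) 1) _ _ (begin
      k (suc u) + deg H′ u + when N 1                              ≡⟨ +-assoc (k (suc u)) _ _ ⟩
      k (suc u) + (deg H′ u + when N 1)                            ≡⟨ cong (k (suc u) +_) (+-comm (deg H′ u) _) ⟩
      k (suc u) + (when N 1 + deg H′ u)                            ≡⟨ cong (k (suc u) +_) (deg-suc H u) ⟨
      k (suc u) + deg H (suc u)                                    ≤⟨ room (suc u) ⟩
      length (L (suc u))                                           ≡⟨ countᵇ+countᵇ-not (allowed H a u) (L (suc u)) ⟨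
      countᵇ (allowed H a u) (L (suc u)) + countᵇ (not ∘ allowed H a u) (L (suc u))
                                                                   ≤⟨ +-monoʳ-≤ _ blocked ⟩
      countᵇ (allowed H a u) (L (suc u)) + when N 1                ≡⟨ cong (_+ when N 1) (length-filterᵇ _ (L (suc u))) ⟨
      length (restricted a u) + when N 1                           ∎)
      where
      open ≤-Reasoning
      N : Bool
      N = adj H zero (suc u)
      blocked : countᵇ (not ∘ allowed H a u) (L (suc u)) ≤ when N 1
      blocked = ≤-trans (≤-reflexive (countᵇ-cong (L (suc u)) (λ b → cong (λ e → not (not N ∨ not e)) (≡ᵇ-sym a b))))
                        (countᵇ-blocked-≤ N a (unique (suc u)))

    ∑≢x ∑≡x : (ℕ → ℕ) → ℕ
    ∑≢x f = ∑[ a ∈ L zero ] when (not (a ≡ᵇ x)) (f a)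
    ∑≡x f = ∑[ a ∈ L zero ] when (a ≡ᵇ x) (f a)

    #ext : ℕ → ℕ
    #ext a = #colourings n (restricted a) (properᵇ H′)

    #ext-avoiding : ℕ → ℕ
    #ext-avoiding a = #colourings n (restricted a) (λ c → properᵇ H′ c ∧ avoidsᵇ x c)

    #ext≡ : ∀ a → #ext a ≡ #colourings n (L ∘ suc) (λ c → properᵇ H′ c ∧ compatible₀ H a c)
    #ext≡ a = #colourings-filterᵇ n (L ∘ suc) (allowed H a) (properᵇ H′)

    #proper≡∑ : #colourings (suc n) L (properᵇ H) ≡ ∑[ a ∈ L zero ] #ext a
    #proper≡∑ = trans (#colourings-∷ L (properᵇ H))
      (∑-cong (L zero) (λ a → trans (countᵇ-cong (choices n (L ∘ suc)) (properᵇ-∷ H a)) (sym (#ext≡ a))))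

    #avoiding≡∑ : #colourings (suc n) L (λ c → properᵇ H c ∧ avoidsᵇ x c) ≡ ∑≢x #ext-avoiding
    #avoiding≡∑ = trans (#colourings-∷ L _) (∑-cong (L zero) λ a → begin
      #colourings n (L ∘ suc) (λ c → properᵇ H (a ∷ᵥ c) ∧ avoidsᵇ x (a ∷ᵥ c))
        ≡⟨ countᵇ-cong (choices n (L ∘ suc)) (λ c → trans (cong₂ _∧_ (properᵇ-∷ H a c) (avoidsᵇ-∷ x a c))
             (rearrange (properᵇ H′ c) (compatible₀ H a c) (not (a ≡ᵇ x)) (avoidsᵇ x c))) ⟩
      #colourings n (L ∘ suc) (λ c → not (a ≡ᵇ x) ∧ (avoiding c ∧ compatible₀ H a c))
        ≡⟨ when-countᵇ (not (a ≡ᵇ x)) (λ c → avoiding c ∧ compatible₀ H a c) (choices n (L ∘ suc)) ⟨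
      when (not (a ≡ᵇ x)) (#colourings n (L ∘ suc) (λ c → avoiding c ∧ compatible₀ H a c))
        ≡⟨ cong (when (not (a ≡ᵇ x))) (#colourings-filterᵇ n (L ∘ suc) (allowed H a) avoiding) ⟨
      when (not (a ≡ᵇ x)) (#ext-avoiding a) ∎)
      where
      open ≡-Reasoning
      avoiding : Vec ℕ n → Bool
      avoiding c = properᵇ H′ c ∧ avoidsᵇ x c
      rearrange : ∀ p q r s → (p ∧ q) ∧ (r ∧ s) ≡ r ∧ ((p ∧ s) ∧ q)
      rearrange p q false s = Bool.∧-zeroʳ (p ∧ q)
      rearrange p q true  s = ∧-swapʳ p q s

    ∑-split-at-x : ∀ (f : ℕ → ℕ) → ∑ (L zero) f ≡ ∑≢x f + ∑≡x f
    ∑-split-at-x f = trans (∑-cong (L zero) (λ a → split (a ≡ᵇ x) (f a))) (∑-+ (L zero) _ _)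
      where
      split : ∀ b m → m ≡ when (not b) m + when b m
      split true  m = refl
      split false m = sym (+-identityʳ m)

    free-colours : ∀ c → k zero ≤ countᵇ (λ a → compatible₀ H a c) (L zero)
    free-colours c = +-cancelʳ-≤ (deg H zero) _ _ (begin
      k zero + deg H zero                  ≤⟨ room zero ⟩
      length (L zero)                      ≤⟨ length≤countᵇ-free+countᵇ-marked (unique zero) neighbour (lookup c) (allFin n) ⟩
      F + countᵇ neighbour (allFin n)     ≡⟨ cong (F +_) (deg-zero H) ⟨
      F + deg H zero                       ∎)
      where
      open ≤-Reasoning
      F : ℕ
      F = countᵇ (λ a → compatible₀ H a c) (L zero)
      neighbour : Fin n → Bool
      neighbour u = adj H zero (suc u)

    #ext-double-count : ∀ (q : ℕ → Bool) → ∑[ a ∈ L zero ] when (q a) (#ext a)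
      ≡ ∑[ c ∈ choices n (L ∘ suc) ] when (properᵇ H′ c) (countᵇ (λ a → q a ∧ compatible₀ H a c) (L zero))
    #ext-double-count q = begin
      ∑[ a ∈ L zero ] when (q a) (#ext a)
        ≡⟨ ∑-cong (L zero) (λ a → trans (cong (when (q a)) (#ext≡ a)) (when-countᵇ (q a) _ X)) ⟩
      ∑[ a ∈ L zero ] countᵇ (λ c → q a ∧ (properᵇ H′ c ∧ compatible₀ H a c)) X
        ≡⟨ ∑-cong (L zero) (λ a → countᵇ-cong X (λ c → ∧-swapˡ (q a) (properᵇ H′ c) (compatible₀ H a c))) ⟩
      ∑[ a ∈ L zero ] countᵇ (λ c → properᵇ H′ c ∧ (q a ∧ compatible₀ H a c)) X
        ≡⟨ ∑-comm (L zero) X (λ a c → when (properᵇ H′ c ∧ (q a ∧ compatible₀ H a c)) 1) ⟩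
      ∑[ c ∈ X ] countᵇ (λ a → properᵇ H′ c ∧ (q a ∧ compatible₀ H a c)) (L zero)
        ≡⟨ ∑-cong X (λ c → when-countᵇ (properᵇ H′ c) (λ a → q a ∧ compatible₀ H a c) (L zero)) ⟨
      ∑[ c ∈ X ] when (properᵇ H′ c) (countᵇ (λ a → q a ∧ compatible₀ H a c) (L zero)) ∎
      where
      open ≡-Reasoning
      X : List (Vec ℕ n)
      X = choices n (L ∘ suc)

    x-extensions-≤ : (k zero ∸ 1) * ∑≡x #ext ≤ ∑≢x #ext
    x-extensions-≤ = begin
      (k zero ∸ 1) * ∑≡x #ext
        ≡⟨ cong ((k zero ∸ 1) *_) (#ext-double-count (_≡ᵇ x)) ⟩
      (k zero ∸ 1) * (∑[ c ∈ X ] when (properᵇ H′ c) (countᵇ (λ a → (a ≡ᵇ x) ∧ compatible₀ H a c) (L zero)))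
        ≤⟨ *-∑-when-mono-≤ (k zero ∸ 1) 1 X (properᵇ H′) (λ c →
             ≤-trans (per-colouring c) (≤-reflexive (sym (*-identityˡ _)))) ⟩
      1 * (∑[ c ∈ X ] when (properᵇ H′ c) (countᵇ (λ a → not (a ≡ᵇ x) ∧ compatible₀ H a c) (L zero)))
        ≡⟨ trans (*-identityˡ _) (sym (#ext-double-count (not ∘ (_≡ᵇ x)))) ⟩
      ∑≢x #ext ∎
      where
      open ≤-Reasoning
      X : List (Vec ℕ n)
      X = choices n (L ∘ suc)
      per-colouring : ∀ c → (k zero ∸ 1) * countᵇ (λ a → (a ≡ᵇ x) ∧ compatible₀ H a c) (L zero)
                                       ≤ countᵇ (λ a → not (a ≡ᵇ x) ∧ compatible₀ H a c) (L zero)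
      per-colouring c = ∸1*≤ (k zero)
        (≤-trans (countᵇ-mono-≤ (L zero) (λ a → proj₁ ∘ Equivalence.to Bool.T-∧)) (countᵇ-≡ᵇ-≤1 x (unique zero)))
        (≤-trans (free-colours c) (≤-reflexive (sym (countᵇ-∧-split (_≡ᵇ x) (λ a → compatible₀ H a c) (L zero)))))

    extend : (∀ a → ∏ᶠ (λ u → k (suc u) ∸ 1) * #ext a ≤ ∏ᶠ (k ∘ suc) * #ext-avoiding a) →
      ∏ᶠ (λ v → k v ∸ 1) * #colourings (suc n) L (properᵇ H)
        ≤ ∏ᶠ k * #colourings (suc n) L (λ c → properᵇ H c ∧ avoidsᵇ x c)
    extend ih = begin
      ∏ᶠ (λ v → k v ∸ 1) * #colourings (suc n) L (properᵇ H)
        ≡⟨ cong₂ _*_ (∏ᶠ-suc (λ v → k v ∸ 1)) (trans #proper≡∑ (∑-split-at-x #ext)) ⟩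
      ((k zero ∸ 1) * ∏ᶠ (λ u → k (suc u) ∸ 1)) * (∑≢x #ext + ∑≡x #ext)
        ≤⟨ combine-≤ (k zero) x-extensions-≤ others-≤ ⟩
      (k zero * ∏ᶠ (k ∘ suc)) * ∑≢x #ext-avoiding
        ≡⟨ cong₂ _*_ (∏ᶠ-suc k) #avoiding≡∑ ⟨
      ∏ᶠ k * #colourings (suc n) L (λ c → properᵇ H c ∧ avoidsᵇ x c) ∎
      where
      open ≤-Reasoning
      others-≤ : ∏ᶠ (λ u → k (suc u) ∸ 1) * ∑≢x #ext ≤ ∏ᶠ (k ∘ suc) * ∑≢x #ext-avoiding
      others-≤ = *-∑-when-mono-≤ (∏ᶠ (λ u → k (suc u) ∸ 1)) (∏ᶠ (k ∘ suc)) (L zero) (λ a → not (a ≡ᵇ x))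
                                  {#ext} {#ext-avoiding} ih

  avoiding-lower-bound : ∀ n (H : Graph n) (L : Fin n → List ℕ) (k : Fin n → ℕ) →
    (∀ v → Unique (L v)) → (∀ v → k v + deg H v ≤ length (L v)) → ∀ x →
    ∏ᶠ (λ v → k v ∸ 1) * #colourings n L (properᵇ H)
      ≤ ∏ᶠ k * #colourings n L (λ c → properᵇ H c ∧ avoidsᵇ x c)
  avoiding-lower-bound zero    H L k unique room x = ≤-refl
  avoiding-lower-bound (suc n) H L k unique room x = extend (λ a →
    avoiding-lower-bound n H′ (restricted a) (k ∘ suc) (restricted-unique a) (restricted-room a) x)
    where open Extension H L k unique room x

open Counting

import Data.Nat as ℕ
import Data.Nat.Properties as ℕ
import Data.Nat.Coprimality as Coprimality
open import Data.Nat.ListAction.Properties using (product≢0)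
open import Data.Integer using (+_)
import Data.Integer as ℤ
import Data.Integer.Properties as ℤ
open import Data.List.Relation.Unary.All using (universal)
open import Data.List.Relation.Unary.All.Properties using (map⁺)
open import Data.Rational using (ℚ; _*_) renaming (_≤_ to _≤ℚ_)
open import Data.Rational using (mkℚ; _/_; 0ℚ; 1ℚ; _+_; _-_; -_; Positive; *≤*)
open import Data.Rational.Properties

open CommSemigroupProperties (CommutativeMonoid.commutativeSemigroup *-1-commutativeMonoid)
  using () renaming (interchange to *-interchange; xy∙z≈xz∙y to *-swapʳ)

ℕ→ℚ≡mkℚ : ∀ m → ℕ→ℚ m ≡ mkℚ (+ m) 0 (Coprimality.sym (Coprimality.1-coprimeTo m))
ℕ→ℚ≡mkℚ m = normalize-coprime (Coprimality.sym (Coprimality.1-coprimeTo m))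

ℕ→ℚ-* : ∀ m n → ℕ→ℚ (m ℕ.* n) ≡ ℕ→ℚ m * ℕ→ℚ n
ℕ→ℚ-* m n = trans (cong (_/ 1) (ℤ.pos-* m n)) (sym (cong₂ _*_ (ℕ→ℚ≡mkℚ m) (ℕ→ℚ≡mkℚ n)))

ℕ→ℚ-+ : ∀ m n → ℕ→ℚ (m ℕ.+ n) ≡ ℕ→ℚ m + ℕ→ℚ n
ℕ→ℚ-+ m n = trans (cong (_/ 1) (trans (ℤ.pos-+ m n) (sym (cong₂ ℤ._+_ (ℤ.*-identityʳ (+ m)) (ℤ.*-identityʳ (+ n))))))
                  (sym (cong₂ _+_ (ℕ→ℚ≡mkℚ m) (ℕ→ℚ≡mkℚ n)))

ℕ→ℚ-mono-≤ : ∀ {m n} → m ≤ n → ℕ→ℚ m ≤ℚ ℕ→ℚ n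
ℕ→ℚ-mono-≤ {m} {n} m≤n rewrite ℕ→ℚ≡mkℚ m | ℕ→ℚ≡mkℚ n =
  *≤* (subst₂ ℤ._≤_ (sym (ℤ.*-identityʳ (+ m))) (sym (ℤ.*-identityʳ (+ n))) (ℤ.+≤+ m≤n))

ℕ→ℚ-positive : ∀ m .{{_ : ℕ.NonZero m}} → Positive (ℕ→ℚ m)
ℕ→ℚ-positive (suc m) rewrite ℕ→ℚ≡mkℚ (suc m) = _

factor-*-ℕ→ℚ : ∀ a d → factor a d * ℕ→ℚ (a ℕ.∸ d) ≡ ℕ→ℚ (a ℕ.∸ d ℕ.∸ 1)
factor-*-ℕ→ℚ a d with a ℕ.∸ d
... | ℕ.zero  = *-zeroˡ (ℕ→ℚ 0)
... | suc j = begin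
  (1ℚ - r) * m                ≡⟨ *-distribʳ-+ m 1ℚ (- r) ⟩
  1ℚ * m + (- r) * m          ≡⟨ cong₂ _+_ (*-identityˡ m) (sym (neg-distribˡ-* r m)) ⟩
  m - r * m                   ≡⟨ cong (λ z → m - z) r*m≡1 ⟩
  m - 1ℚ                      ≡⟨ cong (_- 1ℚ) (trans (ℕ→ℚ-+ 1 j) (+-comm 1ℚ (ℕ→ℚ j))) ⟩
  ℕ→ℚ j + 1ℚ - 1ℚ             ≡⟨ +-assoc (ℕ→ℚ j) 1ℚ (- 1ℚ) ⟩
  ℕ→ℚ j + (1ℚ - 1ℚ)           ≡⟨ cong (λ z → ℕ→ℚ j + z) (+-inverseʳ 1ℚ) ⟩
  ℕ→ℚ j + 0ℚ                  ≡⟨ +-identityʳ (ℕ→ℚ j) ⟩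
  ℕ→ℚ j                       ∎
  where
  open ≡-Reasoning
  r m : ℚ
  r = + 1 / suc j
  m = ℕ→ℚ (suc j)
  r*m≡1 : r * m ≡ 1ℚ
  r*m≡1 rewrite ℕ→ℚ≡mkℚ (suc j) | normalize-coprime {1} {j} (Coprimality.1-coprimeTo (suc j)) =
    *-inverseˡ (mkℚ (+ suc j) 0 (Coprimality.sym (Coprimality.1-coprimeTo (suc j))))

foldr-*-product : ∀ {V : Set} (g : V → ℚ) (f h : V → ℕ) → (∀ v → g v * ℕ→ℚ (f v) ≡ ℕ→ℚ (h v)) →
  ∀ vs →
  foldr (λ v r → g v * r) 1ℚ vs * ℕ→ℚ (product (map f vs)) ≡ ℕ→ℚ (product (map h vs))
foldr-*-product g f h gf≡h []       = *-identityˡ (ℕ→ℚ 1)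
foldr-*-product g f h gf≡h (v ∷ vs) = begin
  g v * G * ℕ→ℚ (f v ℕ.* F)            ≡⟨ cong (g v * G *_) (ℕ→ℚ-* (f v) F) ⟩
  g v * G * (ℕ→ℚ (f v) * ℕ→ℚ F)        ≡⟨ *-interchange (g v) G (ℕ→ℚ (f v)) (ℕ→ℚ F) ⟩
  g v * ℕ→ℚ (f v) * (G * ℕ→ℚ F)        ≡⟨ cong₂ _*_ (gf≡h v) (foldr-*-product g f h gf≡h vs) ⟩
  ℕ→ℚ (h v) * ℕ→ℚ (product (map h vs)) ≡⟨ ℕ→ℚ-* (h v) _ ⟨
  ℕ→ℚ (h v ℕ.* product (map h vs))     ∎
  where
  open ≡-Reasoning
  G : ℚ
  G = foldr (λ v r → g v * r) 1ℚ vs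
  F : ℕ
  F = product (map f vs)

slack : ∀ {n} → Graph n → (Fin n → List ℕ) → Fin n → ℕ
slack H L v = length (L v) ℕ.∸ deg H v

bound-*-∏slack : ∀ {n} (H : Graph n) L →
  bound H L * ℕ→ℚ (∏ᶠ (slack H L)) ≡ ℕ→ℚ (∏ᶠ (λ v → slack H L v ℕ.∸ 1))
bound-*-∏slack {n} H L =
  foldr-*-product (λ v → factor (length (L v)) (deg H v)) (slack H L) (λ v → slack H L v ℕ.∸ 1)
                  (λ v → factor-*-ℕ→ℚ (length (L v)) (deg H v)) (allFin n)

lemmaA1 : ∀ {n} (H : Graph n) (L : Fin n → List ℕ)
    → (∀ v → Unique (L v))
    → (∀ v → suc (deg H v) ≤ length (L v))
    → (x : ℕ) → ∃ (λ v → x ∈ L v)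
    → bound H L * ℕ→ℚ (#proper H L) ≤ℚ ℕ→ℚ (#properAvoiding H L x)
lemmaA1 {n} H L unique deg<length x _ = *-cancelʳ-≤-pos K {{ℕ→ℚ-positive (∏ᶠ k) {{∏ᶠk≢0}}}} (begin
  bound H L * ℕ→ℚ (#proper H L) * K               ≡⟨ *-swapʳ (bound H L) _ K ⟩
  bound H L * K * ℕ→ℚ (#proper H L)               ≡⟨ cong (_* ℕ→ℚ (#proper H L)) (bound-*-∏slack H L) ⟩
  ℕ→ℚ (∏ᶠ k⁻) * ℕ→ℚ (#proper H L)                ≡⟨ ℕ→ℚ-* (∏ᶠ k⁻) _ ⟨
  ℕ→ℚ (∏ᶠ k⁻ ℕ.* #proper H L)                    ≤⟨ ℕ→ℚ-mono-≤ counted ⟩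
  ℕ→ℚ (∏ᶠ k ℕ.* #properAvoiding H L x)           ≡⟨ trans (ℕ→ℚ-* (∏ᶠ k) _) (*-comm K _) ⟩
  ℕ→ℚ (#properAvoiding H L x) * K                 ∎)
  where
  open ≤-Reasoning
  k k⁻ : Fin n → ℕ
  k = slack H L
  k⁻ v = k v ℕ.∸ 1
  K : ℚ
  K = ℕ→ℚ (∏ᶠ k)
  ∏ᶠk≢0 : ℕ.NonZero (∏ᶠ k)
  ∏ᶠk≢0 = product≢0 (map⁺ (universal (λ v → ℕ.>-nonZero (ℕ.m<n⇒0<n∸m (deg<length v))) (allFin n)))
  room : ∀ v → k v ℕ.+ deg H v ≤ length (L v)
  room v = ℕ.≤-reflexive (ℕ.m∸n+n≡m (ℕ.≤-trans (ℕ.n≤1+n _) (deg<length v)))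
  counted : ∏ᶠ k⁻ ℕ.* #proper H L ≤ ∏ᶠ k ℕ.* #properAvoiding H L x
  counted = subst₂ (λ p a → ∏ᶠ k⁻ ℕ.* p ≤ ∏ᶠ k ℕ.* a)
                   (sym (#proper≡#colourings H L)) (sym (#properAvoiding≡#colourings H L x))
                   (avoiding-lower-bound n H L k unique room x)
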